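{- Let $\Gamma$ be a group, $S$ a generating set, $G=\mathrm{Cay}(\Gamma,S)$, $r\ge2$ an integer, and $X$ an $r$-local $2$-separator of $G$. Then no cycle in $G$ of length at most $r$ strongly traverses $X$. In particular, if a word $w$ in $S$ strongly traverses $X$, then $w$ is not a cyclic subword of any morpheme of $\Gamma$ in $S$ of length at most $r$.
   Context: Generating sets $S\subseteq\Gamma\setminus\{\mathbb{I}\}$ are closed under inverses; $\mathrm{Cay}(\Gamma,S)$ is the simple graph on $\Gamma$ with edges $\{g,gs\}$. The ball $B_r(v)$ consists of all vertices and edges on closed walks of length $\le r$ through $v$. For distinct vertices $v_0,v_1$ the connectivity graph $C_r(v_0,v_1)$ has vertex set $N(\{v_0,v_1\})$ (vertices outside $\{v_0,v_1\}$ adjacent to one of them), with $a,b$ adjacent if for some $i$ they lie in the same component of $B_r(v_i)-v_0-v_1$; $\{v_0,v_1\}$ is an $r$-local $2$-separator if $C_r(v_0,v_1)$ is disconnected and $d(v_0,v_1)\le r/2$; its $r$-local components are the components of $C_r(v_0,v_1)$. A strong traversal of $X$ is a walk $y_0y_1y_2y_3$ whose internal vertices $y_1,y_2$ are the two vertices of $X$ and whose ends $y_0,y_3$ lie in distinct $r$-local components at $X$. A cycle strongly traverses $X$ if it contains a strong traversal of $X$ as a subpath; a word $w$ in $S$ strongly traverses $X$ if some walk in $G$ labelled by $w$ (i.e. $v,va_1,va_1a_2,\dots$ for $w=a_1a_2\dots$) contains a strong traversal of $X$ as a subwalk. A morpheme of $\Gamma$ in $S$ is a nonempty word in $S$ with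 product $\mathbb{I}$ such that no nonempty proper contiguous subword has product $\mathbb{I}$. A word $v$ is a cyclic subword of $w$ if $v$ or $v^{ -1}$ is a contiguous subword of a cyclic permutation of $w$. -}

module Defs where

open import Level using (Level; _⊔_)
open import Algebra.Bundles using (Group)
open import Data.Nat using (ℕ; zero; suc; _+_; _*_; _≤_; _<_)
open import Data.List using (List; []; _∷_; _++_; foldr; map; reverse; length)
open import Data.List.Relation.Unary.All using (All)
open import Data.List.Relation.Binary.Pointwise using (Pointwise)
open import Data.Product using (Σ; ∃; ∃-syntax; _×_; _,_)
open import Data.Sum using (_⊎_)
open import Relation.Nullary using (¬_)
open import Relation.Unary using (Pred)
open import Relation.Binary.PropositionalEquality using (_≡_)

-- Everything is relative to a group Γ (a stdlib setoid-group; vertex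
-- equality is the group's _≈_) and a subset S of its carrier.
module Cay {c ℓ s : Level} (Γ : Group c ℓ) (S : Pred (Group.Carrier Γ) s) where

  open Group Γ

  Word : Set c
  Word = List Carrier

  prod : Word → Carrier
  prod = foldr _∙_ ε

  IsGenSet : Set (c ⊔ ℓ ⊔ s)
  IsGenSet = (∀ {x y} → x ≈ y → S x → S y)
           × (∀ {x} → S x → S (x ⁻¹))
           × ¬ S ε
           × (∀ g → ∃[ w ] (All S w × prod w ≈ g))

  Adj : Carrier → Carrier → Set (c ⊔ ℓ ⊔ s)
  Adj g h = ∃[ t ] (S t × h ≈ g ∙ t)

  -- A walk of length k is given by u : ℕ → Carrier (only u 0 … u k matter).
  IsWalk : ℕ → (ℕ → Carrier) → Set (c ⊔ ℓ ⊔ s)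
  IsWalk k u = ∀ i → i < k → Adj (u i) (u (suc i))

  -- distance d(x,y) ≤ r/2  ⟺  some walk of length k from x to y with 2k ≤ r
  DistHalfLe : ℕ → Carrier → Carrier → Set (c ⊔ ℓ ⊔ s)
  DistHalfLe r x y = ∃[ k ] ∃[ u ] (IsWalk k u × u 0 ≈ x × u k ≈ y × 2 * k ≤ r)

  ClosedWalkThrough : ℕ → Carrier → ℕ → (ℕ → Carrier) → Set (c ⊔ ℓ ⊔ s)
  ClosedWalkThrough r v k u =
    k ≤ r × IsWalk k u × u 0 ≈ u k × ∃[ j ] (j ≤ k × u j ≈ v)

  BallV : ℕ → Carrier → Carrier → Set (c ⊔ ℓ ⊔ s)
  BallV r v x = ∃[ k ] ∃[ u ] (ClosedWalkThrough r v k u × ∃[ j ] (j ≤ k × u j ≈ x))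

  BallE : ℕ → Carrier → Carrier → Carrier → Set (c ⊔ ℓ ⊔ s)
  BallE r v x y = ∃[ k ] ∃[ u ] (ClosedWalkThrough r v k u ×
    ∃[ j ] (j < k × ((u j ≈ x × u (suc j) ≈ y) ⊎ (u j ≈ y × u (suc j) ≈ x))))

  Connected : ∀ {p q} → Pred Carrier p → (Carrier → Carrier → Set q)
            → Carrier → Carrier → Set (c ⊔ ℓ ⊔ p ⊔ q)
  Connected V E a b = Σ ℕ λ k → Σ (ℕ → Carrier) λ u → (u 0 ≈ a × u k ≈ b
    × (∀ i → i ≤ k → V (u i)) × (∀ i → i < k → E (u i) (u (suc i))))

  SameCompBall : ℕ → Carrier → Carrier → Carrier → Carrier → Carrier → Set (c ⊔ ℓ ⊔ s)
  SameCompBall r v v0 v1 a b =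
    Connected (λ x → BallV r v x × ¬ x ≈ v0 × ¬ x ≈ v1) (BallE r v) a b

  Nbhd : Carrier → Carrier → Carrier → Set (c ⊔ ℓ ⊔ s)
  Nbhd v0 v1 x = ¬ x ≈ v0 × ¬ x ≈ v1 × (Adj v0 x ⊎ Adj v1 x)

  CEdge : ℕ → Carrier → Carrier → Carrier → Carrier → Set (c ⊔ ℓ ⊔ s)
  CEdge r v0 v1 a b = SameCompBall r v0 v0 v1 a b ⊎ SameCompBall r v1 v0 v1 a b

  SameLocalComp : ℕ → Carrier → Carrier → Carrier → Carrier → Set (c ⊔ ℓ ⊔ s)
  SameLocalComp r v0 v1 = Connected (Nbhd v0 v1) (CEdge r v0 v1)

  IsLocal2Sep : ℕ → Carrier → Carrier → Set (c ⊔ ℓ ⊔ s)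
  IsLocal2Sep r v0 v1 = ¬ v0 ≈ v1
    × (∃[ a ] ∃[ b ] (Nbhd v0 v1 a × Nbhd v0 v1 b × ¬ SameLocalComp r v0 v1 a b))
    × DistHalfLe r v0 v1

  StrongTrav : ℕ → Carrier → Carrier → Carrier → Carrier → Carrier → Carrier → Set (c ⊔ ℓ ⊔ s)
  StrongTrav r x0 x1 y0 y1 y2 y3 =
    Adj y0 y1 × Adj y1 y2 × Adj y2 y3
    × ((y1 ≈ x0 × y2 ≈ x1) ⊎ (y1 ≈ x1 × y2 ≈ x0))
    × Nbhd x0 x1 y0 × Nbhd x0 x1 y3 × ¬ SameLocalComp r x0 x1 y0 y3

  -- a cycle of length n ≥ 3, given as an n-periodic sequence of vertices
  -- with c 0 … c (n-1) pairwise distinct and consecutive vertices adjacent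
  IsCycle : ℕ → (ℕ → Carrier) → Set (c ⊔ ℓ ⊔ s)
  IsCycle n cy = 3 ≤ n
    × (∀ i → cy (i + n) ≈ cy i)
    × (∀ i j → i < n → j < n → cy i ≈ cy j → i ≡ j)
    × (∀ i → Adj (cy i) (cy (suc i)))

  -- the cycle contains a strong traversal of X as a subpath
  -- (traversal is symmetric under reversal, so one direction suffices)
  CycleStronglyTraverses : ℕ → Carrier → Carrier → (ℕ → Carrier) → Set (c ⊔ ℓ ⊔ s)
  CycleStronglyTraverses r x0 x1 cy =
    ∃[ i ] StrongTrav r x0 x1 (cy i) (cy (suc i)) (cy (suc (suc i))) (cy (suc (suc (suc i))))

  WordStronglyTraverses : ℕ → Carrier → Carrier → Word → Set (c ⊔ ℓ ⊔ s)
  WordStronglyTraverses r x0 x1 w =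
    ∃[ v ] ∃[ p ] ∃[ a ] ∃[ b ] ∃[ d ] ∃[ q ] (w ≡ p ++ a ∷ b ∷ d ∷ q
      × StrongTrav r x0 x1 (v ∙ prod p) ((v ∙ prod p) ∙ a)
                          (((v ∙ prod p) ∙ a) ∙ b) ((((v ∙ prod p) ∙ a) ∙ b) ∙ d))

  IsMorpheme : Word → Set (c ⊔ ℓ ⊔ s)
  IsMorpheme m = All S m × ¬ m ≡ [] × prod m ≈ ε
    × (∀ p u q → m ≡ p ++ u ++ q → ¬ u ≡ [] → ¬ p ++ q ≡ [] → ¬ prod u ≈ ε)

  wordInv : Word → Word
  wordInv w = reverse (map _⁻¹ w)

  ContigSub : Word → Word → Set (c ⊔ ℓ)
  ContigSub v w = ∃[ p ] ∃[ q ] Pointwise _≈_ (p ++ v ++ q) w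

  CyclicSub : Word → Word → Set (c ⊔ ℓ)
  CyclicSub v w = ∃[ a ] ∃[ b ] (w ≡ a ++ b
    × (ContigSub v (b ++ a) ⊎ ContigSub (wordInv v) (b ++ a)))

-- Suppose a closed walk of length at most r passes y₀, then the two vertices x₀, x₁
-- of X in some order, then y₃, and never returns to x₀ or x₁. The rest of the walk,
-- from y₃ back to y₀, is a walk in B_r(x₀) − X, because every vertex and edge of it
-- lies on a closed walk of length at most r through x₀, namely the whole walk. Hence
-- y₀ and y₃ are adjacent in C_r(X), so the traversal is not strong. A cycle is such
-- a walk starting at the traversal. For a morpheme, minimality makes the prefix
-- products of every rotation pairwise distinct, so the walk labelled by the rotation
-- that begins with the traversed letters is such a walk as well.
module Submission where

open import Defs
open import Level using (Level; _⊔_)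
open import Algebra.Bundles using (Group)
open import Data.Nat using (ℕ; zero; suc; _+_; _∸_; _≤_; _<_; z≤n; s≤s)
open import Data.Nat.Properties
  using (+-identityʳ; +-suc; +-comm; +-∸-assoc; n∸n≡0; m∸n≤m; <-irrefl; <-trans; <⇒≤;
         ≤-refl; ≤-trans; ≤-pred; <-≤-trans; +-monoʳ-≤; +-monoʳ-<; m≤n⇒m<n∨m≡n)
open import Data.List using (List; []; _∷_; _++_; [_]; length; take; drop; reverse; map)
open import Data.List.Properties
  using (++-assoc; ++-identityʳ; ++-conicalʳ; length-++; take-all; take++drop≡id; map-++; reverse-++)
open import Data.List.Relation.Unary.All using (All; []; _∷_)
open import Data.List.Relation.Unary.All.Properties using (++⁺)
open import Data.List.Relation.Binary.Pointwise using (Pointwise; []; _∷_; All-resp-Pointwise; foldr⁺)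
open import Data.List.Relation.Binary.Pointwise.Properties using (Pointwise-length; symmetric)
open import Data.Product using (∃-syntax; _×_; _,_; proj₁; proj₂)
import Data.Product as Product
open import Data.Sum using (_⊎_; inj₁; inj₂)
import Data.Sum as Sum
open import Relation.Nullary using (¬_)
open import Relation.Unary using (Pred)
open import Relation.Binary.PropositionalEquality as ≡ using (_≡_; _≢_)

length-++-comm : ∀ {a} {A : Set a} (u w : List A) → length (u ++ w) ≡ length (w ++ u)
length-++-comm u w =
  ≡.trans (length-++ u) (≡.trans (+-comm (length u) (length w)) (≡.sym (length-++ w)))

++-reassoc : ∀ {a} {A : Set a} (P X Y Q : List A) → P ++ (X ++ Y) ++ Q ≡ (P ++ X) ++ Y ++ Q
++-reassoc P X Y Q = ≡.trans (≡.cong (P ++_) (++-assoc X Y Q)) (≡.sym (++-assoc P X (Y ++ Q)))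

drop-≢[] : ∀ {a} {A : Set a} {w : List A} {j} → j < length w → drop j w ≢ []
drop-≢[] {w = _ ∷ _} {zero} _ ()
drop-≢[] {w = _ ∷ _} {suc j} (s≤s j<w) = drop-≢[] j<w

split-between : ∀ {a} {A : Set a} (w : List A) {i j} → i < j → j < length w →
  ∃[ u ] ∃[ v ] (w ≡ take i w ++ u ++ v × take j w ≡ take i w ++ u × u ≢ [] × v ≢ [])
split-between (x ∷ w) {zero} {suc j} _ (s≤s j<w) =
  x ∷ take j w , drop j w , ≡.cong (x ∷_) (≡.sym (take++drop≡id j w)) , ≡.refl , (λ ()) , drop-≢[] j<w
split-between (x ∷ w) {suc i} {suc j} (s≤s i<j) (s≤s j<w) with split-between w i<j j<w
... | u , v , w≡ , take-j≡ , u≢[] , v≢[] = u , v , ≡.cong (x ∷_) w≡ , ≡.cong (x ∷_) take-j≡ , u≢[] , v≢[]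

module _ {c ℓ s : Level} (Γ : Group c ℓ) (S : Pred (Group.Carrier Γ) s) where
  open Group Γ
  open Cay Γ S
  open import Algebra.Properties.Group Γ using (∙-cancelˡ; inverseʳ-unique; //-rightDividesʳ)
  open import Relation.Binary.Reasoning.Setoid setoid

  Connected-sym : ∀ {p q} {V : Pred Carrier p} {E : Carrier → Carrier → Set q}
    → (∀ {x y} → E x y → E y x) → ∀ {a b} → Connected V E a b → Connected V E b a
  Connected-sym {E = E} E-sym (k , u , u₀≈a , uₖ≈b , inV , inE) =
    k , (λ j → u (k ∸ j)) , uₖ≈b , trans (reflexive (≡.cong u (n∸n≡0 k))) u₀≈a ,
    (λ j _ → inV (k ∸ j) (m∸n≤m k j)) , reversed
    where
      reversed : ∀ j → j < k → E (u (k ∸ j)) (u (k ∸ suc j))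
      reversed j j<k =
        ≡.subst (λ t → E (u t) (u (k ∸ suc j))) 1+[k∸1+j]≡k∸j
          (E-sym (inE (k ∸ suc j) (≡.subst (_≤ k) (≡.sym 1+[k∸1+j]≡k∸j) (m∸n≤m k j))))
        where
          1+[k∸1+j]≡k∸j : suc (k ∸ suc j) ≡ k ∸ j
          1+[k∸1+j]≡k∸j = ≡.sym (+-∸-assoc 1 j<k)

  Connected-resp : ∀ {p q} {V : Pred Carrier p} {E : Carrier → Carrier → Set q} {a a′ b b′}
    → a ≈ a′ → b ≈ b′ → Connected V E a b → Connected V E a′ b′
  Connected-resp a≈a′ b≈b′ (k , u , u₀≈a , uₖ≈b , walk) = k , u , trans u₀≈a a≈a′ , trans uₖ≈b b≈b′ , walk

  Connected-edge : ∀ {p q} {V : Pred Carrier p} {E : Carrier → Carrier → Set q} {a b}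
    → V a → V b → E a b → Connected V E a b
  Connected-edge {V = V} {E} {a} {b} Va Vb Eab = 1 , ends , refl , refl , inV , inE
    where
      ends : ℕ → Carrier
      ends zero = a
      ends (suc _) = b
      inV : ∀ i → i ≤ 1 → V (ends i)
      inV zero _ = Va
      inV (suc _) _ = Vb
      inE : ∀ i → i < 1 → E (ends i) (ends (suc i))
      inE zero _ = Eab
      inE (suc _) (s≤s ())

  BallE-sym : ∀ {r v x y} → BallE r v x y → BallE r v y x
  BallE-sym (k , u , through , j , j<k , ends) = k , u , through , j , j<k , Sum.swap ends

  SameCompBall-sym : ∀ {r v v0 v1 a b} → SameCompBall r v v0 v1 a b → SameCompBall r v v0 v1 b a
  SameCompBall-sym {r} {v} {v0} {v1} =
    Connected-sym {V = λ x → BallV r v x × ¬ x ≈ v0 × ¬ x ≈ v1} {E = BallE r v} BallE-sym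

  SameCompBall-resp : ∀ {r v v0 v1 a a′ b b′}
    → a ≈ a′ → b ≈ b′ → SameCompBall r v v0 v1 a b → SameCompBall r v v0 v1 a′ b′
  SameCompBall-resp {r} {v} {v0} {v1} =
    Connected-resp {V = λ x → BallV r v x × ¬ x ≈ v0 × ¬ x ≈ v1} {E = BallE r v}

  sameCompBall⇒sameLocalComp : ∀ {r v0 v1 a b} → Nbhd v0 v1 a → Nbhd v0 v1 b
    → SameCompBall r v0 v0 v1 a b → SameLocalComp r v0 v1 a b
  sameCompBall⇒sameLocalComp {r} {v0} {v1} Na Nb c =
    Connected-edge {V = Nbhd v0 v1} {E = CEdge r v0 v1} Na Nb (inj₁ c)

  SameLocalComp-sym : ∀ {r v0 v1 a b} → SameLocalComp r v0 v1 a b → SameLocalComp r v0 v1 b a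
  SameLocalComp-sym {r} {v0} {v1} =
    Connected-sym {V = Nbhd v0 v1} {E = CEdge r v0 v1} (Sum.map SameCompBall-sym SameCompBall-sym)

  Adj-resp : ∀ {g g′ h h′} → g ≈ g′ → h ≈ h′ → Adj g h → Adj g′ h′
  Adj-resp g≈g′ h≈h′ (t , St , h≈gt) = t , St , trans (sym h≈h′) (trans h≈gt (∙-congʳ g≈g′))

  Adj-sym : (∀ {t} → S t → S (t ⁻¹)) → ∀ {g h} → Adj g h → Adj h g
  Adj-sym S⁻¹ {g} {h} (t , St , h≈gt) = t ⁻¹ , S⁻¹ St , (begin
    g           ≈⟨ //-rightDividesʳ t g ⟨
    g ∙ t ∙ t ⁻¹ ≈⟨ ∙-congʳ h≈gt ⟨
    h ∙ t ⁻¹    ∎)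

  Nbhd-resp : ∀ {v0 v1 x x′} → x ≈ x′ → Nbhd v0 v1 x → Nbhd v0 v1 x′
  Nbhd-resp x≈x′ (x≉v0 , x≉v1 , adjacent) =
    (λ e → x≉v0 (trans x≈x′ e)) , (λ e → x≉v1 (trans x≈x′ e)) ,
    Sum.map (Adj-resp refl x≈x′) (Adj-resp refl x≈x′) adjacent

  StrongTrav-resp : ∀ {r x0 x1 y0 y1 y2 y3 y0′ y1′ y2′ y3′}
    → y0 ≈ y0′ → y1 ≈ y1′ → y2 ≈ y2′ → y3 ≈ y3′
    → StrongTrav r x0 x1 y0 y1 y2 y3 → StrongTrav r x0 x1 y0′ y1′ y2′ y3′
  StrongTrav-resp e0 e1 e2 e3 (a01 , a12 , a23 , onX , N0 , N3 , apart) =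
    Adj-resp e0 e1 a01 , Adj-resp e1 e2 a12 , Adj-resp e2 e3 a23 ,
    Sum.map (Product.map (trans (sym e1)) (trans (sym e2)))
            (Product.map (trans (sym e1)) (trans (sym e2))) onX ,
    Nbhd-resp e0 N0 , Nbhd-resp e3 N3 ,
    (λ c → apart (Connected-resp {V = Nbhd _ _} {E = CEdge _ _ _} (sym e0) (sym e3) c))

  StrongTrav-reverse : (∀ {t} → S t → S (t ⁻¹)) → ∀ {r x0 x1 y0 y1 y2 y3}
    → StrongTrav r x0 x1 y0 y1 y2 y3 → StrongTrav r x0 x1 y3 y2 y1 y0
  StrongTrav-reverse S⁻¹ (a01 , a12 , a23 , onX , N0 , N3 , apart) =
    Adj-sym S⁻¹ a23 , Adj-sym S⁻¹ a12 , Adj-sym S⁻¹ a01 ,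
    Sum.swap (Sum.map Product.swap Product.swap onX) ,
    N3 , N0 , (λ c → apart (SameLocalComp-sym c))

  segment-sameCompBall : ∀ {r v v0 v1 k u} → ClosedWalkThrough r v k u
    → ∀ a l → a + l ≤ k → (∀ j → j ≤ l → ¬ u (a + j) ≈ v0 × ¬ u (a + j) ≈ v1)
    → SameCompBall r v v0 v1 (u a) (u (a + l))
  segment-sameCompBall {r} {v} {v0} {v1} {k} {u} through a l a+l≤k avoids =
    l , (λ j → u (a + j)) , reflexive (≡.cong u (+-identityʳ a)) , refl , inV , inE
    where
      inV : ∀ j → j ≤ l → BallV r v (u (a + j)) × ¬ u (a + j) ≈ v0 × ¬ u (a + j) ≈ v1
      inV j j≤l = (k , u , through , a + j , ≤-trans (+-monoʳ-≤ a j≤l) a+l≤k , refl) , avoids j j≤l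
      inE : ∀ j → j < l → BallE r v (u (a + j)) (u (a + suc j))
      inE j j<l = k , u , through , a + j , <-≤-trans (+-monoʳ-< a j<l) a+l≤k ,
        inj₁ (refl , reflexive (≡.cong u (≡.sym (+-suc a j))))

  closedWalk-noStrongTrav : ∀ {r x0 x1 k z} → IsWalk (3 + k) z → 3 + k ≤ r → z 0 ≈ z (3 + k)
    → (∀ j → j ≤ k → ¬ z (3 + j) ≈ z 1 × ¬ z (3 + j) ≈ z 2)
    → ¬ StrongTrav r x0 x1 (z 0) (z 1) (z 2) (z 3)
  closedWalk-noStrongTrav {r} {x0} {x1} {k} {z} walk len≤r closes avoids (_ , _ , _ , onX , N0 , N3 , apart) =
    apart (sameCompBall⇒sameLocalComp N0 N3 (SameCompBall-sym (SameCompBall-resp refl (sym closes) rest)))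
    where
      OnX = (z 1 ≈ x0 × z 2 ≈ x1) ⊎ (z 1 ≈ x1 × z 2 ≈ x0)
      x0-visited : OnX → ∃[ j ] (j ≤ 3 + k × z j ≈ x0)
      x0-visited (inj₁ (z1≈x0 , _)) = 1 , s≤s z≤n , z1≈x0
      x0-visited (inj₂ (_ , z2≈x0)) = 2 , s≤s (s≤s z≤n) , z2≈x0
      avoidsX : OnX → ∀ j → j ≤ k → ¬ z (3 + j) ≈ x0 × ¬ z (3 + j) ≈ x1
      avoidsX (inj₁ (z1≈x0 , z2≈x1)) j j≤k =
        (λ e → proj₁ (avoids j j≤k) (trans e (sym z1≈x0))) , (λ e → proj₂ (avoids j j≤k) (trans e (sym z2≈x1)))
      avoidsX (inj₂ (z1≈x1 , z2≈x0)) j j≤k =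
        (λ e → proj₂ (avoids j j≤k) (trans e (sym z2≈x0))) , (λ e → proj₁ (avoids j j≤k) (trans e (sym z1≈x1)))
      rest : SameCompBall r x0 x0 x1 (z 3) (z (3 + k))
      rest = segment-sameCompBall (len≤r , walk , closes , x0-visited onX) 3 k ≤-refl (avoidsX onX)

  -- Sliding the window by one step, its new last position is a periodic copy of
  -- its old first position.
  cycle-injectiveOnWindows : ∀ {n cy} → IsCycle n cy → ∀ i {p q} → p < q → q < n → ¬ cy (p + i) ≈ cy (q + i)
  cycle-injectiveOnWindows {cy = cy} (_ , _ , injective , _) zero {p} {q} p<q q<n cyp≈cyq =
    <-irrefl (injective p q (<-trans p<q q<n) q<n (begin
      cy p       ≡⟨ ≡.cong cy (+-identityʳ p) ⟨
      cy (p + 0) ≈⟨ cyp≈cyq ⟩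
      cy (q + 0) ≡⟨ ≡.cong cy (+-identityʳ q) ⟩
      cy q       ∎)) p<q
  cycle-injectiveOnWindows {cy = cy} isCycle@(_ , periodic , _ , _) (suc i) {p} {q} p<q q<n cyp≈cyq
    with m≤n⇒m<n∨m≡n q<n
  ... | inj₁ 1+q<n = cycle-injectiveOnWindows isCycle i (s≤s p<q) 1+q<n (begin
        cy (suc p + i) ≡⟨ ≡.cong cy (+-suc p i) ⟨
        cy (p + suc i) ≈⟨ cyp≈cyq ⟩
        cy (q + suc i) ≡⟨ ≡.cong cy (+-suc q i) ⟩
        cy (suc q + i) ∎)
  ... | inj₂ ≡.refl = cycle-injectiveOnWindows isCycle i (s≤s z≤n) (s≤s p<q) (begin
        cy i           ≈⟨ periodic i ⟨
        cy (i + suc q) ≡⟨ ≡.cong cy (≡.trans (+-comm i (suc q)) (≡.sym (+-suc q i))) ⟩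
        cy (q + suc i) ≈⟨ cyp≈cyq ⟨
        cy (p + suc i) ≡⟨ ≡.cong cy (+-suc p i) ⟩
        cy (suc p + i) ∎)

  cycle-noStrongTrav : ∀ {r x0 x1 n cy} → IsCycle n cy → n ≤ r → ¬ CycleStronglyTraverses r x0 x1 cy
  cycle-noStrongTrav {cy = cy} isCycle@(s≤s (s≤s (s≤s (z≤n {k}))) , periodic , _ , adjacent) n≤r (i , trav) =
    closedWalk-noStrongTrav {k = k} {z = λ j → cy (j + i)} (λ j _ → adjacent (j + i)) n≤r closes avoids trav
    where
      closes : cy i ≈ cy (3 + k + i)
      closes = trans (sym (periodic i)) (reflexive (≡.cong cy (+-comm i (3 + k))))
      shifted : ∀ j → cy (2 + j + suc i) ≈ cy (3 + j + i)
      shifted j = reflexive (≡.cong cy (+-suc (2 + j) i))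
      avoids : ∀ j → j ≤ k → ¬ cy (3 + j + i) ≈ cy (1 + i) × ¬ cy (3 + j + i) ≈ cy (2 + i)
      avoids j j≤k =
        (λ e → cycle-injectiveOnWindows isCycle (suc i) (s≤s z≤n) (s≤s (s≤s (s≤s j≤k)))
                 (sym (trans (shifted j) e))) ,
        (λ e → cycle-injectiveOnWindows isCycle (suc i) (s≤s (s≤s z≤n)) (s≤s (s≤s (s≤s j≤k)))
                 (sym (trans (shifted j) e)))

  prefix : Word → ℕ → Carrier
  prefix w j = prod (take j w)

  prod-++ : ∀ u w → prod (u ++ w) ≈ prod u ∙ prod w
  prod-++ [] w = sym (identityˡ (prod w))
  prod-++ (x ∷ u) w = trans (∙-congˡ (prod-++ u w)) (sym (assoc x (prod u) (prod w)))

  prefix-++ : ∀ u w {j} → j ≤ length u → prefix (u ++ w) j ≡ prefix u j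
  prefix-++ u w {zero} _ = ≡.refl
  prefix-++ (x ∷ u) w {suc j} (s≤s j≤u) = ≡.cong (x ∙_) (prefix-++ u w j≤u)

  prefix-length : ∀ w → prefix w (length w) ≡ prod w
  prefix-length w = ≡.cong prod (take-all (length w) w ≤-refl)

  prefix-resp : ∀ {u w} → Pointwise _≈_ u w → ∀ j → prefix u j ≈ prefix w j
  prefix-resp _ zero = refl
  prefix-resp [] (suc j) = refl
  prefix-resp (x≈y ∷ u≈w) (suc j) = ∙-cong x≈y (prefix-resp u≈w j)

  -- Words labelling cycles of the Cayley graph (or a backtrack, for length 2).
  SimpleClosed : Word → Set (c ⊔ ℓ ⊔ s)
  SimpleClosed w = All S w × prod w ≈ ε × (∀ i j → i < j → j < length w → ¬ prefix w i ≈ prefix w j)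

  simpleClosed-distinct : ∀ {w} → SimpleClosed w → ∀ {i j} → 0 < i → i < j → j ≤ length w
    → ¬ prefix w j ≈ prefix w i
  simpleClosed-distinct {w} (_ , closed , distinct) {i} 0<i i<j j≤w e with m≤n⇒m<n∨m≡n j≤w
  ... | inj₁ j<w = distinct i _ i<j j<w (sym e)
  ... | inj₂ ≡.refl = distinct 0 i 0<i i<j (trans (sym (trans (reflexive (prefix-length w)) closed)) e)

  simpleClosed-rotate₁ : ∀ x u → SimpleClosed (x ∷ u) → SimpleClosed (u ++ [ x ])
  simpleClosed-rotate₁ x u sc@(Sx ∷ Su , closed , _) = ++⁺ Su (Sx ∷ []) , closed′ , distinct′
    where
      closed′ : prod (u ++ [ x ]) ≈ ε
      closed′ = begin
        prod (u ++ [ x ]) ≈⟨ prod-++ u [ x ] ⟩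
        prod u ∙ (x ∙ ε)  ≈⟨ ∙-cong (inverseʳ-unique x (prod u) closed) (identityʳ x) ⟩
        x ⁻¹ ∙ x          ≈⟨ inverseˡ x ⟩
        ε                 ∎
      distinct′ : ∀ i j → i < j → j < length (u ++ [ x ]) → ¬ prefix (u ++ [ x ]) i ≈ prefix (u ++ [ x ]) j
      distinct′ i j i<j j<len e = simpleClosed-distinct sc (s≤s z≤n) (s≤s i<j) (s≤s j≤u) (∙-congˡ (begin
          prefix u j            ≡⟨ prefix-++ u [ x ] j≤u ⟨
          prefix (u ++ [ x ]) j ≈⟨ e ⟨
          prefix (u ++ [ x ]) i ≡⟨ prefix-++ u [ x ] (≤-trans (<⇒≤ i<j) j≤u) ⟩
          prefix u i            ∎))
        where
          j≤u : j ≤ length u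
          j≤u = ≤-pred (≡.subst (suc j ≤_) (≡.trans (length-++ u) (+-comm (length u) 1)) j<len)

  simpleClosed-rotate : ∀ u w → SimpleClosed (u ++ w) → SimpleClosed (w ++ u)
  simpleClosed-rotate [] w sc = ≡.subst SimpleClosed (≡.sym (++-identityʳ w)) sc
  simpleClosed-rotate (x ∷ u) w sc =
    ≡.subst SimpleClosed (++-assoc w [ x ] u)
      (simpleClosed-rotate u (w ++ [ x ])
        (≡.subst SimpleClosed (++-assoc u w [ x ]) (simpleClosed-rotate₁ x (u ++ w) sc)))

  simpleClosed-resp : (∀ {x y} → x ≈ y → S x → S y) → ∀ {u w}
    → Pointwise _≈_ u w → SimpleClosed u → SimpleClosed w
  simpleClosed-resp S-resp u≈w (Su , closed , distinct) =
    All-resp-Pointwise S-resp u≈w Su , trans (sym (foldr⁺ ∙-cong refl u≈w)) closed ,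
    λ i j i<j j<w e → distinct i j i<j (≡.subst (j <_) (≡.sym (Pointwise-length u≈w)) j<w)
      (trans (prefix-resp u≈w i) (trans e (sym (prefix-resp u≈w j))))

  morpheme⇒simpleClosed : ∀ {m} → IsMorpheme m → SimpleClosed m
  morpheme⇒simpleClosed {m} (Sm , _ , closed , minimal) = Sm , closed , distinct
    where
      distinct : ∀ i j → i < j → j < length m → ¬ prefix m i ≈ prefix m j
      distinct i j i<j j<m prefix-i≈prefix-j with split-between m i<j j<m
      ... | u , v , m≡ , take-j≡ , u≢[] , v≢[] =
        minimal (take i m) u v m≡ u≢[] (λ iv≡[] → v≢[] (++-conicalʳ (take i m) v iv≡[]))
          (sym (∙-cancelˡ (prefix m i) ε (prod u) (begin
            prefix m i ∙ ε         ≈⟨ identityʳ (prefix m i) ⟩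
            prefix m i             ≈⟨ prefix-i≈prefix-j ⟩
            prefix m j             ≡⟨ ≡.cong prod take-j≡ ⟩
            prod (take i m ++ u)   ≈⟨ prod-++ (take i m) u ⟩
            prefix m i ∙ prod u    ∎)))

  labelledWalk : ∀ g {w} → All S w → IsWalk (length w) (λ j → g ∙ prefix w j)
  labelledWalk g (_∷_ {x} Sx _) zero _ = x , Sx , (begin
    g ∙ (x ∙ ε) ≈⟨ ∙-congˡ (identityʳ x) ⟩
    g ∙ x       ≈⟨ ∙-congʳ (identityʳ g) ⟨
    g ∙ ε ∙ x   ∎)
  labelledWalk g (_∷_ {x} _ Sw) (suc j) (s≤s j<w) =
    Adj-resp (assoc g x _) (assoc g x _) (labelledWalk (g ∙ x) Sw j j<w)

  simpleClosed-noStrongTrav : ∀ {r x0 x1} g a b d u → SimpleClosed (a ∷ b ∷ d ∷ u)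
    → length (a ∷ b ∷ d ∷ u) ≤ r → ¬ StrongTrav r x0 x1 g (g ∙ a) (g ∙ a ∙ b) (g ∙ a ∙ b ∙ d)
  simpleClosed-noStrongTrav g a b d u sc@(Sw , closed , _) len≤r trav =
    closedWalk-noStrongTrav {k = length u} {z = z} (labelledWalk g Sw) len≤r closes avoids
      (StrongTrav-resp (sym (identityʳ g)) (sym z₁≈) (sym z₂≈) (sym z₃≈) trav)
    where
      w = a ∷ b ∷ d ∷ u
      z : ℕ → Carrier
      z j = g ∙ prefix w j
      closes : z 0 ≈ z (length w)
      closes = ∙-congˡ (sym (trans (reflexive (prefix-length w)) closed))
      avoids : ∀ j → j ≤ length u → ¬ z (3 + j) ≈ z 1 × ¬ z (3 + j) ≈ z 2
      avoids j j≤u =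
        (λ e → simpleClosed-distinct sc (s≤s z≤n) (s≤s (s≤s z≤n)) (s≤s (s≤s (s≤s j≤u))) (∙-cancelˡ g _ _ e)) ,
        (λ e → simpleClosed-distinct sc (s≤s z≤n) (s≤s (s≤s (s≤s z≤n))) (s≤s (s≤s (s≤s j≤u))) (∙-cancelˡ g _ _ e))
      z₁≈ : z 1 ≈ g ∙ a
      z₁≈ = ∙-congˡ (identityʳ a)
      z₂≈ : z 2 ≈ g ∙ a ∙ b
      z₂≈ = trans (∙-congˡ (∙-congˡ (identityʳ b))) (sym (assoc g a b))
      z₃≈ : z 3 ≈ g ∙ a ∙ b ∙ d
      z₃≈ = begin
        g ∙ (a ∙ (b ∙ (d ∙ ε))) ≈⟨ ∙-congˡ (∙-congˡ (∙-congˡ (identityʳ d))) ⟩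
        g ∙ (a ∙ (b ∙ d))       ≈⟨ assoc g a (b ∙ d) ⟨
        g ∙ a ∙ (b ∙ d)         ≈⟨ assoc (g ∙ a) b d ⟨
        g ∙ a ∙ b ∙ d           ∎

  morpheme-noStrongTrav : IsGenSet → ∀ {r x0 x1 A B} → IsMorpheme (A ++ B) → length (A ++ B) ≤ r
    → ∀ X a b d Y → Pointwise _≈_ (X ++ a ∷ b ∷ d ∷ Y) (B ++ A)
    → ∀ g → ¬ StrongTrav r x0 x1 g (g ∙ a) (g ∙ a ∙ b) (g ∙ a ∙ b ∙ d)
  morpheme-noStrongTrav (S-resp , _) {r} {A = A} {B} morpheme len≤r X a b d Y subword g =
    simpleClosed-noStrongTrav g a b d (Y ++ X)
      (simpleClosed-rotate X (a ∷ b ∷ d ∷ Y)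
        (simpleClosed-resp S-resp (symmetric sym subword)
          (simpleClosed-rotate A B (morpheme⇒simpleClosed morpheme))))
      (≡.subst (_≤ r) lengths len≤r)
    where
      lengths : length (A ++ B) ≡ length (a ∷ b ∷ d ∷ Y ++ X)
      lengths = ≡.trans (length-++-comm A B)
        (≡.trans (≡.sym (Pointwise-length subword)) (length-++-comm X (a ∷ b ∷ d ∷ Y)))

  wordInv-++ : ∀ u w → wordInv (u ++ w) ≡ wordInv w ++ wordInv u
  wordInv-++ u w = ≡.trans (≡.cong reverse (map-++ _⁻¹ u w)) (reverse-++ (map _⁻¹ u) (map _⁻¹ w))

  wordInv-around : ∀ p a b d q → wordInv (p ++ a ∷ b ∷ d ∷ q) ≡ wordInv q ++ d ⁻¹ ∷ b ⁻¹ ∷ a ⁻¹ ∷ wordInv p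
  wordInv-around p a b d q = ≡.trans (wordInv-++ p (a ∷ b ∷ d ∷ q))
    (≡.trans (≡.cong (_++ wordInv p) (wordInv-++ (a ∷ b ∷ d ∷ []) q)) (++-assoc (wordInv q) _ (wordInv p)))

  word-noStrongTrav : IsGenSet → ∀ {r x0 x1 w m} → WordStronglyTraverses r x0 x1 w
    → IsMorpheme m → length m ≤ r → ¬ CyclicSub w m
  word-noStrongTrav gen (v , p , a , b , d , q , ≡.refl , trav) morpheme len≤r
                    (A , B , ≡.refl , inj₁ (P , Q , subword)) =
    morpheme-noStrongTrav gen {A = A} {B} morpheme len≤r (P ++ p) a b d (q ++ Q)
      (≡.subst (λ t → Pointwise _≈_ t (B ++ A)) (++-reassoc P p (a ∷ b ∷ d ∷ q) Q) subword)
      (v ∙ prod p) trav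
  word-noStrongTrav gen@(_ , S⁻¹ , _) (v , p , a , b , d , q , ≡.refl , trav) morpheme len≤r
                    (A , B , ≡.refl , inj₂ (P , Q , subword)) =
    morpheme-noStrongTrav gen {A = A} {B} morpheme len≤r (P ++ wordInv q) (d ⁻¹) (b ⁻¹) (a ⁻¹) (wordInv p ++ Q)
      (≡.subst (λ t → Pointwise _≈_ t (B ++ A)) inverse-reassoc subword)
      y3 (StrongTrav-resp refl (sym y2≈) (sym y1≈) (sym y0≈) (StrongTrav-reverse S⁻¹ trav))
    where
      y0 = v ∙ prod p
      y1 = y0 ∙ a
      y2 = y1 ∙ b
      y3 = y2 ∙ d
      inverse-reassoc : P ++ wordInv (p ++ a ∷ b ∷ d ∷ q) ++ Q
                      ≡ (P ++ wordInv q) ++ d ⁻¹ ∷ b ⁻¹ ∷ a ⁻¹ ∷ wordInv p ++ Q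
      inverse-reassoc = ≡.trans (≡.cong (λ t → P ++ t ++ Q) (wordInv-around p a b d q))
        (++-reassoc P (wordInv q) (d ⁻¹ ∷ b ⁻¹ ∷ a ⁻¹ ∷ wordInv p) Q)
      peel : ∀ {h} x y → h ≈ x ∙ y → h ∙ y ⁻¹ ≈ x
      peel x y h≈xy = trans (∙-congʳ h≈xy) (//-rightDividesʳ y x)
      y2≈ : y3 ∙ d ⁻¹ ≈ y2
      y2≈ = peel y2 d refl
      y1≈ : y3 ∙ d ⁻¹ ∙ b ⁻¹ ≈ y1
      y1≈ = peel y1 b y2≈
      y0≈ : y3 ∙ d ⁻¹ ∙ b ⁻¹ ∙ a ⁻¹ ≈ y0
      y0≈ = peel y0 a y1≈

lemma5p10 : ∀ {c ℓ s : Level} (Γ : Group c ℓ) (S : Pred (Group.Carrier Γ) s)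
    → Cay.IsGenSet Γ S
    → (r : ℕ) → 2 ≤ r
    → (x0 x1 : Group.Carrier Γ) → Cay.IsLocal2Sep Γ S r x0 x1
    → ((n : ℕ) (cy : ℕ → Group.Carrier Γ) → Cay.IsCycle Γ S n cy → n ≤ r
         → ¬ Cay.CycleStronglyTraverses Γ S r x0 x1 cy)
      × ((w : Cay.Word Γ S) → All S w → Cay.WordStronglyTraverses Γ S r x0 x1 w
         → (m : Cay.Word Γ S) → Cay.IsMorpheme Γ S m → length m ≤ r
         → ¬ Cay.CyclicSub Γ S w m)
lemma5p10 Γ S isGenSet r _ x0 x1 _ =
  (λ n cy isCycle n≤r → cycle-noStrongTrav Γ S {r} {x0} {x1} isCycle n≤r) ,
  (λ w _ traverses m morpheme m≤r → word-noStrongTrav Γ S isGenSet traverses morpheme m≤r)
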